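{- If $(H_{\mathbf{k}})$, $\mathbf{k}\in\mathbb{N}^h$, is a polynomial (respectively strongly polynomial) sequence of simple graphs, then the sequence of looped complements $(\widetilde{H_{\mathbf{k}}})$ is polynomial (respectively strongly polynomial).
   Context: Graphs are finite; for a multigraph $G$ and a graph $H$ (loops allowed), $\mathrm{hom}(G,H)$ counts homomorphisms. $\mathbb{N}$ denotes the positive integers. A sequence $(H_{\mathbf{k}})$ indexed by all $\mathbf{k}\in\mathbb{N}^h$ is polynomial if for every graph $G$ there are finitely many polynomials $p_1(G;\mathbf{x}),\dots,p_m(G;\mathbf{x})$ such that for every $\mathbf{k}$, $\mathrm{hom}(G,H_{\mathbf{k}})=p_\ell(G;\mathbf{k})$ for some $\ell$; it is strongly polynomial if a single polynomial $p(G;\mathbf{x})$ works for all $\mathbf{k}$. The looped complement $\widetilde{H}$ of a simple graph $H$ has vertex set $V(H)$ and has as edges all pairs $\{u,v\}$ with $u,v\in V(H)$ (including $u=v$, i.e. a loop at every vertex) that are not edges of $H$. -}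

module Defs where

open import Data.Nat using (ℕ; zero; suc; _≤_)
open import Data.Bool using (Bool; true; false; not)
open import Data.Fin using (Fin; zero; suc)
open import Data.List using (List; []; _∷_; map; concatMap; length; filterᵇ; allFin)
open import Data.Bool.ListAction using (all)
open import Data.Integer using (+_)
open import Data.List.Relation.Unary.Any using (Any)
open import Data.Product using (_×_; _,_; Σ; ∃)
open import Data.Vec.Functional using (Vector) renaming (_∷_ to _∷ᶠ_)
open import Data.Rational using (ℚ; _+_; _*_; 0ℚ; 1ℚ)
open import Data.Rational as ℚ using ()
open import Relation.Binary.PropositionalEquality using (_≡_)

-- Graphs (loops allowed, no multiple edges): vertex set Fin n,
-- symmetric Boolean adjacency; adj v v ≡ true means a loop at v.

record Graph : Set where
  field
    n   : ℕ
    adj : Fin n → Fin n → Bool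
    sym : ∀ u v → adj u v ≡ adj v u
open Graph public

Simple : Graph → Set
Simple H = ∀ v → adj H v v ≡ false

-- Looped complement: {u,v} (u = v allowed) is an edge iff it is not an
-- edge of H.  For simple H this puts a loop at every vertex.
loopedComplement : Graph → Graph
loopedComplement H = record
  { n   = n H
  ; adj = λ u v → not (adj H u v)
  ; sym = λ u v → cong-not (sym H u v) }
  where
    cong-not : ∀ {a b} → a ≡ b → not a ≡ not b
    cong-not Relation.Binary.PropositionalEquality.refl = Relation.Binary.PropositionalEquality.refl

-- Multigraphs (finite; multiple edges and loops allowed): vertex set
-- Fin m, edges given as a list (with repetitions) of endpoint pairs.
record Multigraph : Set where
  field
    m     : ℕ
    edges : List (Fin m × Fin m)
open Multigraph public

allFuns : ∀ m k → List (Fin m → Fin k)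
allFuns zero    k = (λ ()) ∷ []
allFuns (suc m) k = concatMap (λ f → map (λ x → x ∷ᶠ f) (allFin k)) (allFuns m k)

isHom : (G : Multigraph) (H : Graph) → (Fin (m G) → Fin (n H)) → Bool
isHom G H f = all (λ e → adj H (f (Data.Product.proj₁ e)) (f (Data.Product.proj₂ e))) (edges G)

hom : Multigraph → Graph → ℕ
hom G H = length (filterᵇ (isHom G H) (allFuns (m G) (n H)))

-- Multivariate polynomials in h variables with rational coefficients,
-- as finite lists of (coefficient, exponent vector) monomials.

Poly : ℕ → Set
Poly h = List (ℚ × (Fin h → ℕ))

toℚ : ℕ → ℚ
toℚ x = (+ x) ℚ./ 1

pow : ℚ → ℕ → ℚ
pow x zero    = 1ℚ
pow x (suc e) = x * pow x e

prodFin : ∀ h → (Fin h → ℚ) → ℚ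
prodFin zero    f = 1ℚ
prodFin (suc h) f = f zero * prodFin h (λ i → f (suc i))

evalMono : ∀ {h} → (Fin h → ℕ) → (Fin h → ℕ) → ℚ
evalMono {h} es x = prodFin h (λ i → pow (toℚ (x i)) (es i))

eval : ∀ {h} → Poly h → (Fin h → ℕ) → ℚ
eval []             x = 0ℚ
eval ((c , es) ∷ p) x = c * evalMono es x + eval p x

-- Sequences indexed by k ∈ ℕ^h (positive integers).  A sequence is a
-- function on Fin h → ℕ; only indices with all entries ≥ 1 matter.

Positive : ∀ {h} → (Fin h → ℕ) → Set
Positive k = ∀ i → 1 ≤ k i

Sequence : ℕ → Set
Sequence h = (Fin h → ℕ) → Graph

IsPolynomial : ∀ {h} → Sequence h → Set
IsPolynomial {h} H =
  (G : Multigraph) → Σ (List (Poly h)) λ ps →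
    (k : Fin h → ℕ) → Positive k →
      Any (λ p → toℚ (hom G (H k)) ≡ eval p k) ps

IsStronglyPolynomial : ∀ {h} → Sequence h → Set
IsStronglyPolynomial {h} H =
  (G : Multigraph) → Σ (Poly h) λ p →
    (k : Fin h → ℕ) → Positive k →
      toℚ (hom G (H k)) ≡ eval p k

-- A map f : V(G) → V(H) is a homomorphism into the looped complement of H
-- exactly when no edge of G is sent onto an edge of H.  Inclusion–exclusion
-- over the set A of edges that are sent onto edges of H gives
--   hom(G, H̃) = Σ_{A ⊆ E(G)} (-1)^|A| hom(G_A, H),
-- where G_A is the spanning subgraph of G with edge set A.  For H = H_k the
-- right-hand side is a fixed rational combination, independent of k, of
-- homomorphism counts into H_k, and (strongly) polynomial functions of k are
-- closed under such combinations.
module Submission where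

open import Defs hiding (sym)
open import Data.Nat using (ℕ; suc)
open import Data.Fin using (Fin)
open import Data.Product using (_×_; _,_; proj₁; proj₂; Σ)

open import Algebra.Bundles using (Ring)
open import Data.Bool using (Bool; true; false; not; _∧_)
open import Data.Bool.ListAction using (all)
open import Data.List using (List; []; _∷_; _++_; map; concatMap; length; filterᵇ)
open import Data.List.Relation.Unary.Any as Any using (Any; here)
open import Data.List.Relation.Unary.Any.Properties using (map⁺; concatMap⁺)
open import Function using (_∘_)
open import Level using (Level)

private variable
  a b : Level
  X : Set a
  Y : Set b

-- Sublists are taken by position, so repeated entries (parallel edges) are
-- distinguished.
sublists : List X → List (List X)
sublists []       = [] ∷ []
sublists (x ∷ xs) = sublists xs ++ map (x ∷_) (sublists xs)

module FiniteSum {c ℓ} (R : Ring c ℓ) where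

  open Ring R
  open import Algebra.Properties.Ring R using (-‿distribˡ-*; -‿+-comm; -0#≈0#)
  open import Algebra.Properties.CommutativeSemigroup +-commutativeSemigroup using (interchange)
  open import Relation.Binary.Reasoning.Setoid setoid

  ∑ : List X → (X → Carrier) → Carrier
  ∑ []       f = 0#
  ∑ (x ∷ xs) f = f x + ∑ xs f

  ∑-cong : ∀ (xs : List X) {f g : X → Carrier} → (∀ x → f x ≈ g x) → ∑ xs f ≈ ∑ xs g
  ∑-cong []       f≈g = refl
  ∑-cong (x ∷ xs) f≈g = +-cong (f≈g x) (∑-cong xs f≈g)

  ∑-zero : ∀ (xs : List X) → ∑ xs (λ _ → 0#) ≈ 0#
  ∑-zero []       = refl
  ∑-zero (x ∷ xs) = trans (+-identityˡ _) (∑-zero xs)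

  ∑-++ : ∀ (xs ys : List X) f → ∑ (xs ++ ys) f ≈ ∑ xs f + ∑ ys f
  ∑-++ []       ys f = sym (+-identityˡ _)
  ∑-++ (x ∷ xs) ys f = trans (+-congˡ (∑-++ xs ys f)) (sym (+-assoc (f x) _ _))

  ∑-map : ∀ (xs : List X) (g : X → Y) f → ∑ (map g xs) f ≈ ∑ xs (λ x → f (g x))
  ∑-map []       g f = refl
  ∑-map (x ∷ xs) g f = +-congˡ (∑-map xs g f)

  ∑-+ : ∀ (xs : List X) f g → ∑ xs (λ x → f x + g x) ≈ ∑ xs f + ∑ xs g
  ∑-+ []       f g = sym (+-identityˡ _)
  ∑-+ (x ∷ xs) f g = trans (+-congˡ (∑-+ xs f g)) (interchange (f x) (g x) _ _)

  ∑-*ˡ : ∀ (xs : List X) c f → ∑ xs (λ x → c * f x) ≈ c * ∑ xs f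
  ∑-*ˡ []       c f = sym (zeroʳ c)
  ∑-*ˡ (x ∷ xs) c f = trans (+-congˡ (∑-*ˡ xs c f)) (sym (distribˡ c (f x) _))

  ∑-neg : ∀ (xs : List X) f → ∑ xs (λ x → - f x) ≈ - ∑ xs f
  ∑-neg []       f = sym -0#≈0#
  ∑-neg (x ∷ xs) f = trans (+-congˡ (∑-neg xs f)) (-‿+-comm (f x) _)

  ∑-comm : ∀ (xs : List X) (ys : List Y) (F : X → Y → Carrier) →
           ∑ xs (λ x → ∑ ys (F x)) ≈ ∑ ys (λ y → ∑ xs (λ x → F x y))
  ∑-comm []       ys F = sym (∑-zero ys)
  ∑-comm (x ∷ xs) ys F = begin
    ∑ ys (F x) + ∑ xs (λ x′ → ∑ ys (F x′))         ≈⟨ +-congˡ (∑-comm xs ys F) ⟩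
    ∑ ys (F x) + ∑ ys (λ y → ∑ xs (λ x′ → F x′ y)) ≈⟨ ∑-+ ys (F x) _ ⟨
    ∑ ys (λ y → F x y + ∑ xs (λ x′ → F x′ y))      ∎

  ∑-sublists-∷ : ∀ x (xs : List X) f →
    ∑ (sublists (x ∷ xs)) f ≈ ∑ (sublists xs) f + ∑ (sublists xs) (λ A → f (x ∷ A))
  ∑-sublists-∷ x xs f =
    trans (∑-++ (sublists xs) _ f) (+-congˡ (∑-map (sublists xs) (x ∷_) f))

  indicator : Bool → Carrier
  indicator true  = 1#
  indicator false = 0#

  sign : List X → Carrier
  sign []       = 1#
  sign (_ ∷ xs) = - sign xs

  inclusion-exclusion : ∀ (P : X → Bool) xs →
    indicator (all (λ x → not (P x)) xs) ≈ ∑ (sublists xs) (λ A → sign A * indicator (all P A))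
  inclusion-exclusion P []       = sym (trans (+-identityʳ _) (*-identityˡ 1#))
  inclusion-exclusion P (x ∷ xs) =
    trans (step (P x)) (sym (∑-sublists-∷ x xs term))
    where
    term : List _ → Carrier
    term A = sign A * indicator (all P A)
    S = ∑ (sublists xs) term
    step : ∀ b → indicator (not b ∧ all (λ x → not (P x)) xs)
                 ≈ S + ∑ (sublists xs) (λ A → - sign A * indicator (b ∧ all P A))
    step true = sym (begin
      S + ∑ (sublists xs) (λ A → - sign A * indicator (all P A))
        ≈⟨ +-congˡ (∑-cong (sublists xs) (λ A → -‿distribˡ-* (sign A) _)) ⟨
      S + ∑ (sublists xs) (λ A → - term A) ≈⟨ +-congˡ (∑-neg (sublists xs) term) ⟩
      S - S                                ≈⟨ -‿inverseʳ S ⟩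
      0#                                   ∎)
    step false = begin
      indicator (all (λ x → not (P x)) xs)      ≈⟨ inclusion-exclusion P xs ⟩
      S                                         ≈⟨ +-identityʳ S ⟨
      S + 0#                                    ≈⟨ +-congˡ (∑-zero (sublists xs)) ⟨
      S + ∑ (sublists xs) (λ _ → 0#)            ≈⟨ +-congˡ (∑-cong (sublists xs) (λ A → zeroʳ (- sign A))) ⟨
      S + ∑ (sublists xs) (λ A → - sign A * 0#) ∎

open import Data.Rational using (ℚ; _+_; _*_; 1ℚ; mkℚ; toℚᵘ)
import Data.Rational.Properties as ℚ
import Data.Rational.Unnormalised as ℚᵘ
import Data.Rational.Unnormalised.Properties as ℚᵘ
import Data.Integer as ℤ
import Data.Integer.Properties as ℤ
import Data.Nat.Coprimality as Coprime
open import Relation.Binary.PropositionalEquality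
  using (_≡_; _≗_; refl; trans; sym; cong; cong₂; module ≡-Reasoning)

open FiniteSum ℚ.+-*-ring

-- toℚ is defined through normalisation; the unnormalised sums compare
-- numerators directly.
toℚ-suc : ∀ x → toℚ (suc x) ≡ 1ℚ + toℚ x
toℚ-suc x = ℚ.toℚᵘ-injective (ℚᵘ.≃-trans unnormalised (ℚᵘ.≃-sym (ℚ.toℚᵘ-homo-+ 1ℚ (toℚ x))))
  where
  toℚ≡mkℚ : ∀ y → toℚ y ≡ mkℚ (ℤ.+ y) 0 (Coprime.sym (Coprime.1-coprimeTo y))
  toℚ≡mkℚ y = ℚ.normalize-coprime (Coprime.sym (Coprime.1-coprimeTo y))
  unnormalised : toℚᵘ (toℚ (suc x)) ℚᵘ.≃ toℚᵘ 1ℚ ℚᵘ.+ toℚᵘ (toℚ x)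
  unnormalised rewrite toℚ≡mkℚ (suc x) | toℚ≡mkℚ x =
    ℚᵘ.*≡* (trans (ℤ.*-identityʳ _)
                  (sym (trans (ℤ.*-identityʳ _) (cong (ℤ._+_ (ℤ.+ 1)) (ℤ.*-identityʳ (ℤ.+ x))))))

toℚ-length-filterᵇ : ∀ (p : X → Bool) xs →
  toℚ (length (filterᵇ p xs)) ≡ ∑ xs (λ x → indicator (p x))
toℚ-length-filterᵇ p []       = refl
toℚ-length-filterᵇ p (x ∷ xs) with p x
... | true  = trans (toℚ-suc (length (filterᵇ p xs))) (cong (1ℚ +_) (toℚ-length-filterᵇ p xs))
... | false = trans (toℚ-length-filterᵇ p xs) (sym (ℚ.+-identityˡ _))

spanningSubgraph : (G : Multigraph) → List (Fin (m G) × Fin (m G)) → Multigraph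
spanningSubgraph G A = record { m = m G ; edges = A }

hom-loopedComplement : ∀ G H →
  toℚ (hom G (loopedComplement H))
    ≡ ∑ (sublists (edges G)) (λ A → sign A * toℚ (hom (spanningSubgraph G A) H))
hom-loopedComplement G H = begin
  toℚ (hom G (loopedComplement H))
    ≡⟨ toℚ-length-filterᵇ (isHom G (loopedComplement H)) maps ⟩
  ∑ maps (λ f → indicator (all (λ e → not (edgeOf f e)) (edges G)))
    ≡⟨ ∑-cong maps (λ f → inclusion-exclusion (edgeOf f) (edges G)) ⟩
  ∑ maps (λ f → ∑ (sublists (edges G)) (λ A → sign A * indicator (all (edgeOf f) A)))
    ≡⟨ ∑-comm maps (sublists (edges G)) _ ⟩
  ∑ (sublists (edges G)) (λ A → ∑ maps (λ f → sign A * indicator (all (edgeOf f) A)))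
    ≡⟨ ∑-cong (sublists (edges G)) (λ A → ∑-*ˡ maps (sign A) _) ⟩
  ∑ (sublists (edges G)) (λ A → sign A * ∑ maps (λ f → indicator (all (edgeOf f) A)))
    ≡⟨ ∑-cong (sublists (edges G)) (λ A →
         cong (sign A *_) (sym (toℚ-length-filterᵇ (isHom (spanningSubgraph G A) H) maps))) ⟩
  ∑ (sublists (edges G)) (λ A → sign A * toℚ (hom (spanningSubgraph G A) H)) ∎
  where
  open ≡-Reasoning
  maps = allFuns (m G) (n H)
  edgeOf : (Fin (m G) → Fin (n H)) → Fin (m G) × Fin (m G) → Bool
  edgeOf f (u , v) = adj H (f u) (f v)

module _ {h : ℕ} where

  scale : ℚ → Poly h → Poly h
  scale c = map (λ (d , es) → (c * d , es))

  eval-scale : ∀ c (p : Poly h) k → eval (scale c p) k ≡ c * eval p k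
  eval-scale c []              k = sym (ℚ.*-zeroʳ c)
  eval-scale c ((d , es) ∷ p) k = begin
    c * d * evalMono es k + eval (scale c p) k ≡⟨ cong₂ _+_ (ℚ.*-assoc c d _) (eval-scale c p k) ⟩
    c * (d * evalMono es k) + c * eval p k     ≡⟨ ℚ.*-distribˡ-+ c _ _ ⟨
    c * (d * evalMono es k + eval p k)         ∎
    where open ≡-Reasoning

  eval-++ : ∀ (p q : Poly h) k → eval (p ++ q) k ≡ eval p k + eval q k
  eval-++ []              q k = sym (ℚ.+-identityˡ _)
  eval-++ ((d , es) ∷ p) q k =
    trans (cong (d * evalMono es k +_) (eval-++ p q k))
          (sym (ℚ.+-assoc (d * evalMono es k) (eval p k) (eval q k)))

  eval-scale-++ : ∀ c (p q : Poly h) k → eval (scale c p ++ q) k ≡ c * eval p k + eval q k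
  eval-scale-++ c p q k = trans (eval-++ (scale c p) q k) (cong (_+ eval q k) (eval-scale c p k))

  linearCombination : List X → (X → ℚ) → (X → Poly h) → Poly h
  linearCombination []       c q = []
  linearCombination (x ∷ xs) c q = scale (c x) (q x) ++ linearCombination xs c q

  eval-linearCombination : ∀ (xs : List X) c q k →
    eval (linearCombination xs c q) k ≡ ∑ xs (λ x → c x * eval (q x) k)
  eval-linearCombination []       c q k = refl
  eval-linearCombination (x ∷ xs) c q k =
    trans (eval-scale-++ (c x) (q x) _ k)
          (cong (c x * eval (q x) k +_) (eval-linearCombination xs c q k))

  linearCombinations : List X → (X → ℚ) → (X → List (Poly h)) → List (Poly h)
  linearCombinations []       c qs = [] ∷ []
  linearCombinations (x ∷ xs) c qs =
    concatMap (λ q → map (scale (c x) q ++_) (linearCombinations xs c qs)) (qs x)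

  any-linearCombinations : ∀ (xs : List X) c qs (v : X → ℚ) k →
    (∀ x → Any (λ q → v x ≡ eval q k) (qs x)) →
    Any (λ p → ∑ xs (λ x → c x * v x) ≡ eval p k) (linearCombinations xs c qs)
  any-linearCombinations []       c qs v k v∈qs = here refl
  any-linearCombinations (x ∷ xs) c qs v k v∈qs = concatMap⁺ _ (Any.map extend (v∈qs x))
    where
    extend : ∀ {q} → v x ≡ eval q k →
      Any (λ p → ∑ (x ∷ xs) (λ y → c y * v y) ≡ eval p k)
          (map (scale (c x) q ++_) (linearCombinations xs c qs))
    extend {q} vx≡q = map⁺ (Any.map (λ {r} rest≡r →
        trans (cong₂ _+_ (cong (c x *_) vx≡q) rest≡r) (sym (eval-scale-++ (c x) q r k)))
      (any-linearCombinations xs c qs v k v∈qs))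

  StronglyPolynomialFn : ((Fin h → ℕ) → ℚ) → Set
  StronglyPolynomialFn f = Σ (Poly h) λ p → ∀ k → Positive k → f k ≡ eval p k

  PolynomialFn : ((Fin h → ℕ) → ℚ) → Set
  PolynomialFn f = Σ (List (Poly h)) λ ps → ∀ k → Positive k → Any (λ p → f k ≡ eval p k) ps

  stronglyPolynomialFn-resp : ∀ {f g} → f ≗ g → StronglyPolynomialFn f → StronglyPolynomialFn g
  stronglyPolynomialFn-resp f≗g (p , f≡p) = p , λ k k⁺ → trans (sym (f≗g k)) (f≡p k k⁺)

  polynomialFn-resp : ∀ {f g} → f ≗ g → PolynomialFn f → PolynomialFn g
  polynomialFn-resp f≗g (ps , f∈ps) = ps , λ k k⁺ → Any.map (trans (sym (f≗g k))) (f∈ps k k⁺)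

  stronglyPolynomialFn-∑ : ∀ (xs : List X) (c : X → ℚ) (f : X → (Fin h → ℕ) → ℚ) →
    (∀ x → StronglyPolynomialFn (f x)) → StronglyPolynomialFn (λ k → ∑ xs (λ x → c x * f x k))
  stronglyPolynomialFn-∑ xs c f poly =
    linearCombination xs c (proj₁ ∘ poly) , λ k k⁺ →
      trans (∑-cong xs (λ x → cong (c x *_) (proj₂ (poly x) k k⁺)))
            (sym (eval-linearCombination xs c (proj₁ ∘ poly) k))

  polynomialFn-∑ : ∀ (xs : List X) (c : X → ℚ) (f : X → (Fin h → ℕ) → ℚ) →
    (∀ x → PolynomialFn (f x)) → PolynomialFn (λ k → ∑ xs (λ x → c x * f x k))
  polynomialFn-∑ xs c f poly =
    linearCombinations xs c (proj₁ ∘ poly) , λ k k⁺ →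
      any-linearCombinations xs c (proj₁ ∘ poly) (λ x → f x k) k (λ x → proj₂ (poly x) k k⁺)

-- The expansion of hom(G, H̃) holds for every graph H.
proposition3p2 : (h : ℕ) (H : Sequence h) →
    ((k : Fin h → ℕ) → Positive k → Simple (H k)) →
    (IsPolynomial H → IsPolynomial (λ k → loopedComplement (H k)))
    × (IsStronglyPolynomial H → IsStronglyPolynomial (λ k → loopedComplement (H k)))
proposition3p2 h H _ = polynomial , stronglyPolynomial
  where
  homSpanning : (G : Multigraph) → List (Fin (m G) × Fin (m G)) → (Fin h → ℕ) → ℚ
  homSpanning G A k = toℚ (hom (spanningSubgraph G A) (H k))

  expansion : ∀ G → (λ k → ∑ (sublists (edges G)) (λ A → sign A * homSpanning G A k))
                    ≗ (λ k → toℚ (hom G (loopedComplement (H k))))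
  expansion G k = sym (hom-loopedComplement G (H k))

  polynomial : IsPolynomial H → IsPolynomial (λ k → loopedComplement (H k))
  polynomial poly G = polynomialFn-resp (expansion G)
    (polynomialFn-∑ (sublists (edges G)) sign (homSpanning G) (λ A → poly (spanningSubgraph G A)))

  stronglyPolynomial : IsStronglyPolynomial H → IsStronglyPolynomial (λ k → loopedComplement (H k))
  stronglyPolynomial poly G = stronglyPolynomialFn-resp (expansion G)
    (stronglyPolynomialFn-∑ (sublists (edges G)) sign (homSpanning G) (λ A → poly (spanningSubgraph G A)))
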